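{- Let $w\in S_n$ with $\ell(w)=\ell$. For every saturated chain $C=(\mathrm{id}=w_0\lessdot w_1\lessdot\cdots\lessdot w_\ell=w)$ in $[\mathrm{id},w]$, we have $G_C\preceq_\ell \mathrm{Inv}(w)$.
   Context: $S_n$ is the symmetric group on $[n]$; $\mathrm{Inv}(w)$ is the set of pairs $(a,b)$, $a<b$, with $w(a)>w(b)$, and $\ell(w)=|\mathrm{Inv}(w)|$. For $a<b$, $wt_{ab}$ swaps entries in positions $a,b$. Bruhat covers: $u\lessdot v$ iff $v=ut_{ab}$ ($a<b$) and $\ell(v)=\ell(u)+1$. The generating set of a saturated chain $C=(u_0\lessdot\cdots\lessdot u_\ell)$ is the multiset $G_C=\{(a_i,b_i): u_i=u_{i-1}t_{a_ib_i},\ a_i<b_i,\ i\in[\ell]\}$. On pairs $(a,b)$ of positive integers with $a<b$, set $(a,b)\preceq(c,d)$ iff $[a,b]\subseteq[c,d]$. For multisets $G,H$ of such pairs each with $\ell$ elements, $G\preceq_\ell H$ means there is a bijective pairing of the elements of $G$ with those of $H$ such that for each paired $((a,b),(c,d))\in G\times H$ one has $(a,b)\preceq(c,d)$. -}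

module Defs where

open import Data.Nat using (ℕ; suc)
open import Data.Fin using (Fin; zero; suc; fromℕ; inject₁; _<_; _≤_; _>_; _<?_)
open import Data.Fin.Permutation using (Permutation′; _⟨$⟩ʳ_; transpose)
open import Data.Product using (_×_; _,_; Σ; ∃-syntax)
open import Data.List using (List; length; filter; cartesianProduct; allFin)
open import Data.List.Relation.Binary.Pointwise using (Pointwise)
open import Data.List.Relation.Binary.Permutation.Propositional using (_↭_)
open import Data.Vec.Functional using (Vector; toList)
open import Relation.Nullary using (Dec; _×-dec_)
open import Relation.Binary.PropositionalEquality using (_≡_)

-- Positions [n] are represented by Fin n (0-indexed).
Pair : ℕ → Set
Pair n = Fin n × Fin n

isInv : ∀ {n} → Permutation′ n → Pair n → Set
isInv w (a , b) = (a < b) × ((w ⟨$⟩ʳ a) > (w ⟨$⟩ʳ b))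

isInv? : ∀ {n} (w : Permutation′ n) (p : Pair n) → Dec (isInv w p)
isInv? w (a , b) = (a <? b) ×-dec ((w ⟨$⟩ʳ b) <? (w ⟨$⟩ʳ a))

Inv : ∀ {n} → Permutation′ n → List (Pair n)
Inv {n} w = filter (isInv? w) (cartesianProduct (allFin n) (allFin n))

len : ∀ {n} → Permutation′ n → ℕ
len w = length (Inv w)

-- u t_{ab}: (u t_{ab})(i) = u(t_{ab}(i)), swapping the entries in positions a,b
Cover : ∀ {n} → Permutation′ n → Permutation′ n → Pair n → Set
Cover u v (a , b) =
  (a < b) × (∀ i → v ⟨$⟩ʳ i ≡ u ⟨$⟩ʳ (transpose a b ⟨$⟩ʳ i)) × (len v ≡ suc (len u))

record SatChain {n : ℕ} (ℓ : ℕ) (w : Permutation′ n) : Set where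
  field
    elems  : Fin (suc ℓ) → Permutation′ n
    gens   : Vector (Pair n) ℓ
    start  : ∀ i → elems zero ⟨$⟩ʳ i ≡ i
    finish : ∀ i → elems (fromℕ ℓ) ⟨$⟩ʳ i ≡ w ⟨$⟩ʳ i
    covers : ∀ (k : Fin ℓ) → Cover (elems (inject₁ k)) (elems (suc k)) (gens k)

-- The multiset G_C (as a list)
GenSet : ∀ {n ℓ} {w : Permutation′ n} → SatChain ℓ w → List (Pair n)
GenSet C = toList (SatChain.gens C)

_⪯_ : ∀ {n} → Pair n → Pair n → Set
(a , b) ⪯ (c , d) = (c ≤ a) × (b ≤ d)

-- G ⪯ℓ H: a bijective pairing of elements of G with those of H, pairwise ⪯.
-- Realised as: some rearrangement H' of H is pointwise ⪯-above G.
_⪯ℓ_ : ∀ {n} → List (Pair n) → List (Pair n) → Set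
G ⪯ℓ H = ∃[ H' ] (H' ↭ H × Pointwise _⪯_ G H')

{-# OPTIONS --safe #-}

-- Let v = u t_ab with a < b and u(a) < u(b).  Send an inversion (p,q) of u to the pair
-- obtained by replacing p with t_ab(p) if q > b and u(a) < u(q), and q with t_ab(q) if
-- p < a and u(p) < u(b).  This is an involution of all pairs fixing (a,b), and it maps
-- Inv(u) into Inv(v) \ {(a,b)}, each pair to one whose interval contains it.  Hence
-- ℓ(u) < ℓ(v); in particular a cover u ⋖ u t_ab has u(a) < u(b), and since then
-- ℓ(v) = ℓ(u) + 1 the injection (a,b) ∷ Inv(u) → Inv(v) is a bijection, witnessing
-- (a,b) ∷ Inv(u) ⪯ℓ Inv(v).  Composing these along the chain, starting from
-- Inv(id) = [], gives G_C ⪯ℓ Inv(w).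

module Submission where

open import Defs
open import Data.Nat as ℕ using (ℕ; zero; suc; _+_)
import Data.Nat.Properties as ℕ
open import Data.Fin as Fin using (Fin; zero; suc; fromℕ; inject₁; _<_; _≤_; _≟_)
import Data.Fin.Properties as Fin
import Data.Fin.Permutation.Components as PC
open import Data.Fin.Permutation using (Permutation′; _⟨$⟩ʳ_; _⟨$⟩ˡ_; inverseˡ)
open import Data.Bool using (Bool; true; false)
open import Data.Product using (_×_; _,_; proj₁; proj₂; ∃-syntax)
open import Data.List using (List; []; _∷_; _++_; length; map; cartesianProduct; allFin)
import Data.List.Properties as List
open import Data.List.Membership.Propositional using (_∈_)
open import Data.List.Membership.Propositional.Properties
  using (∈-∃++; ∈-filter⁺; ∈-filter⁻; ∈-cartesianProduct⁺; ∈-allFin; ∈-map⁻)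
open import Data.List.Relation.Unary.Any using (here; there)
open import Data.List.Relation.Unary.All as All using (All)
open import Data.List.Relation.Unary.AllPairs using (_∷_)
open import Data.List.Relation.Unary.Unique.Propositional using (Unique)
import Data.List.Relation.Unary.Unique.Propositional.Properties as Unique
open import Data.List.Relation.Binary.Subset.Propositional using (_⊆_)
open import Data.List.Relation.Binary.Pointwise as Pointwise using (Pointwise; []; _∷_)
open import Data.List.Relation.Binary.Permutation.Propositional as ↭
  using (_↭_; ↭-refl; ↭-sym; ↭-trans; prep; swap)
import Data.List.Relation.Binary.Permutation.Propositional.Properties as ↭
open import Data.Vec.Functional using (Vector; toList)
open import Data.Empty using (⊥-elim)
open import Function using (_∘_)
open import Relation.Nullary using (¬_; Dec; yes; no; does; _×-dec_)
open import Relation.Nullary.Decidable using (dec-true; dec-false)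
open import Relation.Binary.Definitions using (tri<; tri≈; tri>)
open import Relation.Binary.PropositionalEquality

module _ {A B : Set} {R : A → B → Set} where

  Pointwise-↭ˡ : ∀ {xs xs′ ys} → Pointwise R xs ys → xs ↭ xs′ →
                 ∃[ ys′ ] (ys ↭ ys′ × Pointwise R xs′ ys′)
  Pointwise-↭ˡ rs ↭.refl = _ , ↭-refl , rs
  Pointwise-↭ˡ (r ∷ rs) (prep x p) with ys′ , q , rs′ ← Pointwise-↭ˡ rs p =
    _ , prep _ q , r ∷ rs′
  Pointwise-↭ˡ (r ∷ r′ ∷ rs) (swap x y p) with ys′ , q , rs′ ← Pointwise-↭ˡ rs p =
    _ , swap _ _ q , r′ ∷ r ∷ rs′
  Pointwise-↭ˡ rs (↭.trans p p′)
    with ys₁ , q , rs₁ ← Pointwise-↭ˡ rs p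
    with ys₂ , q′ , rs₂ ← Pointwise-↭ˡ rs₁ p′ = ys₂ , ↭-trans q q′ , rs₂

  Pointwise-map : ∀ {f : A → B} {xs} → All (λ x → R x (f x)) xs → Pointwise R xs (map f xs)
  Pointwise-map All.[] = []
  Pointwise-map (r All.∷ rs) = r ∷ Pointwise-map rs

module _ {A : Set} where

  ∉-∷⊆⇒↭∷ : ∀ {x : A} {xs ys} → All (x ≢_) xs → x ∷ xs ⊆ ys → ∃[ ys′ ] (ys ↭ x ∷ ys′ × xs ⊆ ys′)
  ∉-∷⊆⇒↭∷ {x} x∉xs x∷xs⊆ys with as , bs , refl ← ∈-∃++ (x∷xs⊆ys (here refl)) =
    as ++ bs , ↭.shift x as bs , xs⊆as++bs
    where
    xs⊆as++bs : _ ⊆ as ++ bs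
    xs⊆as++bs z∈xs with ↭.∈-resp-↭ (↭.shift x as bs) (x∷xs⊆ys (there z∈xs))
    ... | here refl = ⊥-elim (All.lookup x∉xs z∈xs refl)
    ... | there z∈as++bs = z∈as++bs

  Unique-⊆⇒↭++ : ∀ {xs ys : List A} → Unique xs → xs ⊆ ys → ∃[ zs ] (ys ↭ xs ++ zs)
  Unique-⊆⇒↭++ {[]} {ys} _ _ = ys , ↭-refl
  Unique-⊆⇒↭++ {x ∷ xs} (x∉xs ∷ unique) x∷xs⊆ys
    with ys′ , p , xs⊆ys′ ← ∉-∷⊆⇒↭∷ x∉xs x∷xs⊆ys
    with zs , q ← Unique-⊆⇒↭++ unique xs⊆ys′ = zs , ↭-trans p (prep x q)

  Unique-⊆⇒length≤ : ∀ {xs ys : List A} → Unique xs → xs ⊆ ys → length xs ℕ.≤ length ys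
  Unique-⊆⇒length≤ {xs} unique xs⊆ys with zs , p ← Unique-⊆⇒↭++ unique xs⊆ys =
    ℕ.≤-trans (ℕ.m≤m+n (length xs) (length zs))
              (ℕ.≤-reflexive (sym (trans (↭.↭-length p) (List.length-++ xs))))

  Unique-⊆-length≡⇒↭ : ∀ {xs ys : List A} → Unique xs → xs ⊆ ys →
                       length ys ≡ length xs → xs ↭ ys
  Unique-⊆-length≡⇒↭ {xs} {ys} unique xs⊆ys |ys|≡|xs| with Unique-⊆⇒↭++ unique xs⊆ys
  ... | [] , p = ↭-sym (subst (_ ↭_) (List.++-identityʳ xs) p)
  ... | z ∷ zs , p = ⊥-elim (ℕ.m+1+n≰m (length xs) (ℕ.≤-reflexive (begin
    length xs + suc (length zs) ≡⟨ List.length-++ xs ⟨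
    length (xs ++ z ∷ zs)       ≡⟨ ↭.↭-length p ⟨
    length ys                   ≡⟨ |ys|≡|xs| ⟩
    length xs                   ∎)))
    where open ≡-Reasoning

module _ {n : ℕ} where

  ⪯-refl : {x : Pair n} → x ⪯ x
  ⪯-refl {_ , _} = Fin.≤-refl , Fin.≤-refl

  ⪯-trans : {x y z : Pair n} → x ⪯ y → y ⪯ z → x ⪯ z
  ⪯-trans {_ , _} {_ , _} {_ , _} (c≤a , b≤d) (e≤c , d≤f) =
    Fin.≤-trans e≤c c≤a , Fin.≤-trans b≤d d≤f

  ⪯ℓ-refl : (G : List (Pair n)) → G ⪯ℓ G
  ⪯ℓ-refl G = G , ↭-refl , Pointwise.refl ⪯-refl

  ⪯ℓ-trans : {G H K : List (Pair n)} → G ⪯ℓ H → H ⪯ℓ K → G ⪯ℓ K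
  ⪯ℓ-trans (H′ , H′↭H , G⪯H′) (K′ , K′↭K , H⪯K′)
    with K″ , K′↭K″ , H′⪯K″ ← Pointwise-↭ˡ H⪯K′ (↭-sym H′↭H) =
    K″ , ↭-trans (↭-sym K′↭K″) K′↭K , Pointwise.transitive ⪯-trans G⪯H′ H′⪯K″

  ⪯ℓ-respˡ-↭ : {G G′ H : List (Pair n)} → G ↭ G′ → G ⪯ℓ H → G′ ⪯ℓ H
  ⪯ℓ-respˡ-↭ G↭G′ (H′ , H′↭H , G⪯H′) with H″ , H′↭H″ , G′⪯H″ ← Pointwise-↭ˡ G⪯H′ G↭G′ =
    H″ , ↭-trans (↭-sym H′↭H″) H′↭H , G′⪯H″

  ⪯ℓ-++⁺ˡ : (F : List (Pair n)) {G H : List (Pair n)} → G ⪯ℓ H → (F ++ G) ⪯ℓ (F ++ H)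
  ⪯ℓ-++⁺ˡ F (H′ , H′↭H , G⪯H′) =
    F ++ H′ , ↭.++⁺ˡ F H′↭H , Pointwise.++⁺ (Pointwise.refl ⪯-refl) G⪯H′

module _ {n : ℕ} (w : Permutation′ n) where

  Inv⁺ : ∀ {x} → isInv w x → x ∈ Inv w
  Inv⁺ {p , q} = ∈-filter⁺ (isInv? w) (∈-cartesianProduct⁺ (∈-allFin p) (∈-allFin q))

  Inv⁻ : ∀ {x} → x ∈ Inv w → isInv w x
  Inv⁻ x∈Inv = proj₂ (∈-filter⁻ (isInv? w) {xs = cartesianProduct (allFin n) (allFin n)} x∈Inv)

  Inv-unique : Unique (Inv w)
  Inv-unique = Unique.filter⁺ (isInv? w)
    (Unique.cartesianProduct⁺ (Unique.allFin⁺ n) (Unique.allFin⁺ n))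

  ⟨$⟩ʳ-injective : ∀ {i j} → w ⟨$⟩ʳ i ≡ w ⟨$⟩ʳ j → i ≡ j
  ⟨$⟩ʳ-injective {i} {j} wi≡wj = begin
    i                     ≡⟨ inverseˡ w ⟨
    w ⟨$⟩ˡ (w ⟨$⟩ʳ i)     ≡⟨ cong (w ⟨$⟩ˡ_) wi≡wj ⟩
    w ⟨$⟩ˡ (w ⟨$⟩ʳ j)     ≡⟨ inverseˡ w ⟩
    j                     ∎
    where open ≡-Reasoning

module _ {n : ℕ} where

  isInv-cong : {w w′ : Permutation′ n} → (∀ i → w ⟨$⟩ʳ i ≡ w′ ⟨$⟩ʳ i) →
               ∀ {x} → isInv w x → isInv w′ x
  isInv-cong w≗w′ {p , q} (p<q , wq<wp) = p<q , subst₂ _<_ (w≗w′ q) (w≗w′ p) wq<wp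

  Inv-cong : {w w′ : Permutation′ n} → (∀ i → w ⟨$⟩ʳ i ≡ w′ ⟨$⟩ʳ i) → Inv w ≡ Inv w′
  Inv-cong {w} {w′} w≗w′ = List.filter-≐ (isInv? w) (isInv? w′)
    (isInv-cong {w = w} {w′} w≗w′ , isInv-cong {w = w′} {w} (sym ∘ w≗w′))
    (cartesianProduct (allFin n) (allFin n))

  Inv-identity : {w : Permutation′ n} → (∀ i → w ⟨$⟩ʳ i ≡ i) → Inv w ≡ []
  Inv-identity {w} w≗id =
    List.filter-none (isInv? w) {xs = cartesianProduct (allFin n) (allFin n)}
      (All.tabulate λ _ → noInv)
    where
    noInv : ∀ {x} → ¬ isInv w x
    noInv {p , q} (p<q , wq<wp) = Fin.<-asym p<q (subst₂ _<_ (w≗id q) (w≗id p) wq<wp)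

module Transposition {n : ℕ} {a b : Fin n} (a<b : a < b) where

  t : Fin n → Fin n
  t = PC.transpose a b

  a≢b : a ≢ b
  a≢b = Fin.<⇒≢ a<b

  t-a : t a ≡ b
  t-a rewrite dec-true (a ≟ a) refl = refl

  t-b : t b ≡ a
  t-b rewrite dec-false (b ≟ a) (a≢b ∘ sym) | dec-true (b ≟ b) refl = refl

  t-fixes : ∀ {k} → k ≢ a → k ≢ b → t k ≡ k
  t-fixes {k} k≢a k≢b rewrite dec-false (k ≟ a) k≢a | dec-false (k ≟ b) k≢b = refl

  data View (k : Fin n) : Set where
    at-a  : k ≡ a → View k
    at-b  : k ≡ b → View k
    fixed : k ≢ a → k ≢ b → View k

  view : ∀ k → View k
  view k with k ≟ a | k ≟ b
  ... | yes k≡a | _       = at-a k≡a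
  ... | no _    | yes k≡b = at-b k≡b
  ... | no k≢a  | no k≢b  = fixed k≢a k≢b

  t-involutive : ∀ k → t (t k) ≡ k
  t-involutive k with view k
  ... | at-a refl       = trans (cong t t-a) t-b
  ... | at-b refl       = trans (cong t t-b) t-a
  ... | fixed k≢a k≢b   = trans (cong t (t-fixes k≢a k≢b)) (t-fixes k≢a k≢b)

  ≤-t : ∀ {k} → k ≢ b → k ≤ t k
  ≤-t {k} k≢b with view k
  ... | at-a refl     = subst (a ≤_) (sym t-a) (ℕ.<⇒≤ a<b)
  ... | at-b refl     = ⊥-elim (k≢b refl)
  ... | fixed k≢a _   = Fin.≤-reflexive (sym (t-fixes k≢a k≢b))

  t-≤ : ∀ {k} → k ≢ a → t k ≤ k
  t-≤ {k} k≢a with view k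
  ... | at-a refl     = ⊥-elim (k≢a refl)
  ... | at-b refl     = subst (_≤ b) (sym t-b) (ℕ.<⇒≤ a<b)
  ... | fixed _ k≢b   = Fin.≤-reflexive (t-fixes k≢a k≢b)

  module Transposed {u v : Permutation′ n} (v≗u∘t : ∀ i → v ⟨$⟩ʳ i ≡ u ⟨$⟩ʳ t i) where

    v∘t≗u : ∀ k → v ⟨$⟩ʳ t k ≡ u ⟨$⟩ʳ k
    v∘t≗u k = trans (v≗u∘t (t k)) (cong (u ⟨$⟩ʳ_) (t-involutive k))

    v≗u-on-fixed : ∀ {k} → t k ≡ k → v ⟨$⟩ʳ k ≡ u ⟨$⟩ʳ k
    v≗u-on-fixed {k} tk≡k = trans (v≗u∘t k) (cong (u ⟨$⟩ʳ_) tk≡k)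

    va≡ub : v ⟨$⟩ʳ a ≡ u ⟨$⟩ʳ b
    va≡ub = trans (v≗u∘t a) (cong (u ⟨$⟩ʳ_) t-a)

    vb≡ua : v ⟨$⟩ʳ b ≡ u ⟨$⟩ʳ a
    vb≡ua = trans (v≗u∘t b) (cong (u ⟨$⟩ʳ_) t-b)

  module Widening (u v : Permutation′ n) (v≗u∘t : ∀ i → v ⟨$⟩ʳ i ≡ u ⟨$⟩ʳ t i)
                  (ua<ub : u ⟨$⟩ʳ a < u ⟨$⟩ʳ b) where

    open Transposed {u} {v} v≗u∘t

    LowLeft : Fin n → Set
    LowLeft p = p < a × u ⟨$⟩ʳ p < u ⟨$⟩ʳ b

    HighRight : Fin n → Set
    HighRight q = b < q × u ⟨$⟩ʳ a < u ⟨$⟩ʳ q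

    lowLeft? : ∀ p → Dec (LowLeft p)
    lowLeft? p = (p Fin.<? a) ×-dec (u ⟨$⟩ʳ p Fin.<? u ⟨$⟩ʳ b)

    highRight? : ∀ q → Dec (HighRight q)
    highRight? q = (b Fin.<? q) ×-dec (u ⟨$⟩ʳ a Fin.<? u ⟨$⟩ʳ q)

    swapIf : Bool → Fin n → Fin n
    swapIf true  k = t k
    swapIf false k = k

    widenBy : ∀ {p q} → Dec (LowLeft p) → Dec (HighRight q) → Pair n
    widenBy {p} {q} lowLeft highRight = swapIf (does highRight) p , swapIf (does lowLeft) q

    widen : Pair n → Pair n
    widen (p , q) = widenBy (lowLeft? p) (highRight? q)

    lowLeft?-a : does (lowLeft? a) ≡ false
    lowLeft?-a = dec-false (lowLeft? a) (Fin.<-irrefl refl ∘ proj₁)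

    lowLeft?-b : does (lowLeft? b) ≡ false
    lowLeft?-b = dec-false (lowLeft? b) (Fin.<-asym a<b ∘ proj₁)

    highRight?-a : does (highRight? a) ≡ false
    highRight?-a = dec-false (highRight? a) (Fin.<-asym a<b ∘ proj₁)

    highRight?-b : does (highRight? b) ≡ false
    highRight?-b = dec-false (highRight? b) (Fin.<-irrefl refl ∘ proj₁)

    lowLeft?-swapIf : ∀ c p → does (lowLeft? (swapIf c p)) ≡ does (lowLeft? p)
    lowLeft?-swapIf false p = refl
    lowLeft?-swapIf true  p with view p
    ... | at-a refl     rewrite t-a | lowLeft?-a | lowLeft?-b = refl
    ... | at-b refl     rewrite t-b | lowLeft?-a | lowLeft?-b = refl
    ... | fixed p≢a p≢b rewrite t-fixes p≢a p≢b = refl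

    highRight?-swapIf : ∀ c q → does (highRight? (swapIf c q)) ≡ does (highRight? q)
    highRight?-swapIf false q = refl
    highRight?-swapIf true  q with view q
    ... | at-a refl     rewrite t-a | highRight?-a | highRight?-b = refl
    ... | at-b refl     rewrite t-b | highRight?-a | highRight?-b = refl
    ... | fixed q≢a q≢b rewrite t-fixes q≢a q≢b = refl

    swapIf-involutive : ∀ c k → swapIf c (swapIf c k) ≡ k
    swapIf-involutive true  k = t-involutive k
    swapIf-involutive false k = refl

    widen-involutive : ∀ x → widen (widen x) ≡ x
    widen-involutive (p , q)
      rewrite highRight?-swapIf (does (lowLeft? p)) q | lowLeft?-swapIf (does (highRight? q)) p =
      cong₂ _,_ (swapIf-involutive (does (highRight? q)) p)
                (swapIf-involutive (does (lowLeft? p)) q)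

    widen-injective : ∀ {x y} → widen x ≡ widen y → x ≡ y
    widen-injective {x} {y} wx≡wy = begin
      x                 ≡⟨ widen-involutive x ⟨
      widen (widen x)   ≡⟨ cong widen wx≡wy ⟩
      widen (widen y)   ≡⟨ widen-involutive y ⟩
      y                 ∎
      where open ≡-Reasoning

    widen-ab : widen (a , b) ≡ (a , b)
    widen-ab rewrite highRight?-b | lowLeft?-a = refl

    isInv-via-t : ∀ {p q} → p < q → u ⟨$⟩ʳ t q < u ⟨$⟩ʳ t p → isInv v (p , q)
    isInv-via-t {p} {q} p<q ut-q<ut-p = p<q , subst₂ _<_ (sym (v≗u∘t q)) (sym (v≗u∘t p)) ut-q<ut-p

    ab-isInv : isInv v (a , b)
    ab-isInv = a<b , subst₂ _<_ (sym vb≡ua) (sym va≡ub) ua<ub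

    ab-¬isInv : ¬ isInv u (a , b)
    ab-¬isInv (_ , ub<ua) = Fin.<-asym ua<ub ub<ua

    ≮∧≢⇒> : ∀ {i j : Fin n} → ¬ i < j → j ≢ i → j < i
    ≮∧≢⇒> i≮j j≢i = Fin.≤∧≢⇒< (ℕ.≮⇒≥ i≮j) j≢i

    u∘t-kept : ∀ {p q} → isInv u (p , q) → ¬ LowLeft p → ¬ HighRight q →
               u ⟨$⟩ʳ t q < u ⟨$⟩ʳ t p
    u∘t-kept {p} {q} (p<q , uq<up) ¬lowLeft ¬highRight with view p | view q
    ... | at-a refl | at-a refl = ⊥-elim (Fin.<-irrefl refl p<q)
    ... | at-a refl | at-b refl = ⊥-elim (ab-¬isInv (p<q , uq<up))
    ... | at-a refl | fixed q≢a q≢b rewrite t-a | t-fixes q≢a q≢b = Fin.<-trans uq<up ua<ub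
    ... | at-b refl | at-a refl = ⊥-elim (Fin.<-asym p<q a<b)
    ... | at-b refl | at-b refl = ⊥-elim (Fin.<-irrefl refl p<q)
    ... | at-b refl | fixed q≢a q≢b rewrite t-b | t-fixes q≢a q≢b =
      ≮∧≢⇒> (¬highRight ∘ (p<q ,_)) (q≢a ∘ ⟨$⟩ʳ-injective u)
    ... | fixed p≢a p≢b | at-a refl rewrite t-a | t-fixes p≢a p≢b =
      ≮∧≢⇒> (¬lowLeft ∘ (p<q ,_)) (p≢b ∘ sym ∘ ⟨$⟩ʳ-injective u)
    ... | fixed p≢a p≢b | at-b refl rewrite t-b | t-fixes p≢a p≢b = Fin.<-trans ua<ub uq<up
    ... | fixed p≢a p≢b | fixed q≢a q≢b rewrite t-fixes p≢a p≢b | t-fixes q≢a q≢b = uq<up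

    isInv-widened : ∀ {p q p′ q′} → isInv u (p , q) → p′ ≤ p → q ≤ q′ →
                    v ⟨$⟩ʳ p′ ≡ u ⟨$⟩ʳ p → v ⟨$⟩ʳ q′ ≡ u ⟨$⟩ʳ q →
                    isInv v (p′ , q′) × (p , q) ⪯ (p′ , q′)
    isInv-widened (p<q , uq<up) p′≤p q≤q′ vp′≡up vq′≡uq =
      (ℕ.≤-<-trans p′≤p (ℕ.<-≤-trans p<q q≤q′) , subst₂ _<_ (sym vq′≡uq) (sym vp′≡up) uq<up) ,
      p′≤p , q≤q′

    LowLeft⇒t-fixes : ∀ {p} → LowLeft p → t p ≡ p
    LowLeft⇒t-fixes (p<a , _) = t-fixes (Fin.<⇒≢ p<a) (Fin.<⇒≢ (Fin.<-trans p<a a<b))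

    HighRight⇒t-fixes : ∀ {q} → HighRight q → t q ≡ q
    HighRight⇒t-fixes (b<q , _) = t-fixes (Fin.<⇒≢ (Fin.<-trans a<b b<q) ∘ sym) (Fin.<⇒≢ b<q ∘ sym)

    LowLeft⇒≢b : ∀ {p q} → isInv u (p , q) → LowLeft p → q ≢ b
    LowLeft⇒≢b (_ , uq<up) (_ , up<ub) refl = Fin.<-asym uq<up up<ub

    HighRight⇒≢a : ∀ {p q} → isInv u (p , q) → HighRight q → p ≢ a
    HighRight⇒≢a (_ , uq<up) (_ , ua<uq) refl = Fin.<-asym uq<up ua<uq

    widenBy-isInv : ∀ {p q} → isInv u (p , q) →
                    (lowLeft : Dec (LowLeft p)) (highRight : Dec (HighRight q)) →
                    isInv v (widenBy lowLeft highRight) × (p , q) ⪯ widenBy lowLeft highRight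
    widenBy-isInv inv (no ¬lowLeft) (no ¬highRight) =
      isInv-via-t (proj₁ inv) (u∘t-kept inv ¬lowLeft ¬highRight) , ⪯-refl
    widenBy-isInv {q = q} inv (yes lowLeft) (no _) =
      isInv-widened inv Fin.≤-refl (≤-t (LowLeft⇒≢b inv lowLeft))
        (v≗u-on-fixed (LowLeft⇒t-fixes lowLeft)) (v∘t≗u q)
    widenBy-isInv {p = p} inv (no _) (yes highRight) =
      isInv-widened inv (t-≤ (HighRight⇒≢a inv highRight)) Fin.≤-refl
        (v∘t≗u p) (v≗u-on-fixed (HighRight⇒t-fixes highRight))
    widenBy-isInv {p} {q} inv (yes lowLeft) (yes highRight) =
      isInv-widened inv (t-≤ (HighRight⇒≢a inv highRight)) (≤-t (LowLeft⇒≢b inv lowLeft))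
        (v∘t≗u p) (v∘t≗u q)

    widen-isInv : ∀ {x} → isInv u x → isInv v (widen x) × x ⪯ widen x
    widen-isInv {p , q} inv = widenBy-isInv inv (lowLeft? p) (highRight? q)

    widenedInv : List (Pair n)
    widenedInv = (a , b) ∷ map widen (Inv u)

    widenedInv-unique : Unique widenedInv
    widenedInv-unique = All.tabulate ab∉ ∷ Unique.map⁺ widen-injective (Inv-unique u)
      where
      ab∉ : ∀ {x} → x ∈ map widen (Inv u) → (a , b) ≢ x
      ab∉ x∈ ab≡x with y , y∈Inv , refl ← ∈-map⁻ widen x∈ =
        ab-¬isInv (subst (isInv u) (widen-injective (trans (sym ab≡x) (sym widen-ab)))
                         (Inv⁻ u y∈Inv))

    widenedInv⊆Inv : widenedInv ⊆ Inv v
    widenedInv⊆Inv (here refl) = Inv⁺ v ab-isInv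
    widenedInv⊆Inv (there x∈) with y , y∈Inv , refl ← ∈-map⁻ widen x∈ =
      Inv⁺ v (proj₁ (widen-isInv (Inv⁻ u y∈Inv)))

    widenedInv-length : length widenedInv ≡ suc (len u)
    widenedInv-length = cong suc (List.length-map widen (Inv u))

    ⪯-widenedInv : Pointwise _⪯_ ((a , b) ∷ Inv u) widenedInv
    ⪯-widenedInv = ⪯-refl ∷ Pointwise-map (All.tabulate (proj₂ ∘ widen-isInv ∘ Inv⁻ u))

    len-u<len-v : len u ℕ.< len v
    len-u<len-v = subst (ℕ._≤ len v) widenedInv-length
                        (Unique-⊆⇒length≤ widenedInv-unique widenedInv⊆Inv)

descent⇒len> : ∀ {n} (u v : Permutation′ n) {a b : Fin n} (a<b : a < b) →
               (∀ i → v ⟨$⟩ʳ i ≡ u ⟨$⟩ʳ PC.transpose a b i) →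
               u ⟨$⟩ʳ b < u ⟨$⟩ʳ a → len v ℕ.< len u
descent⇒len> u v a<b v≗u∘t ub<ua =
  Widening.len-u<len-v v u (sym ∘ v∘t≗u) (subst₂ _<_ (sym va≡ub) (sym vb≡ua) ub<ua)
  where
  open Transposition a<b
  open Transposed {u} {v} v≗u∘t

module _ {n : ℕ} where

  Cover⇒ascent : ∀ {u v : Permutation′ n} {a b} → Cover u v (a , b) → u ⟨$⟩ʳ a < u ⟨$⟩ʳ b
  Cover⇒ascent {u} {v} {a} {b} (a<b , v≗u∘t , len-v≡1+len-u)
    with Fin.<-cmp (u ⟨$⟩ʳ a) (u ⟨$⟩ʳ b)
  ... | tri< ua<ub _ _ = ua<ub
  ... | tri≈ _ ua≡ub _ = ⊥-elim (Fin.<⇒≢ a<b (⟨$⟩ʳ-injective u ua≡ub))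
  ... | tri> _ _ ub<ua =
    ⊥-elim (ℕ.<-asym (ℕ.≤-reflexive (sym len-v≡1+len-u)) (descent⇒len> u v a<b v≗u∘t ub<ua))

  Cover⇒⪯ℓ : ∀ {u v : Permutation′ n} x → Cover u v x → (x ∷ Inv u) ⪯ℓ Inv v
  Cover⇒⪯ℓ {u} {v} (a , b) cover@(a<b , v≗u∘t , len-v≡1+len-u) =
    widenedInv , Unique-⊆-length≡⇒↭ widenedInv-unique widenedInv⊆Inv
                   (trans len-v≡1+len-u (sym widenedInv-length)) ,
    ⪯-widenedInv
    where open Transposition.Widening a<b u v v≗u∘t (Cover⇒ascent {u} {v} cover)

chain-⪯ℓ : ∀ {n} (m : ℕ) (w : Fin (suc m) → Permutation′ n) (g : Vector (Pair n) m) →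
           (∀ k → Cover (w (inject₁ k)) (w (suc k)) (g k)) →
           (toList g ++ Inv (w zero)) ⪯ℓ Inv (w (fromℕ m))
chain-⪯ℓ zero    w g covers = ⪯ℓ-refl (Inv (w zero))
chain-⪯ℓ {n} (suc m) w g covers =
  ⪯ℓ-trans first-step (chain-⪯ℓ m (w ∘ suc) (g ∘ suc) (covers ∘ suc))
  where
  G′ : List (Pair n)
  G′ = toList (g ∘ suc)
  first-step : (g zero ∷ G′ ++ Inv (w zero)) ⪯ℓ (G′ ++ Inv (w (suc zero)))
  first-step = ⪯ℓ-respˡ-↭ (↭.shift (g zero) G′ (Inv (w zero)))
    (⪯ℓ-++⁺ˡ G′ (Cover⇒⪯ℓ {u = w zero} {w (suc zero)} (g zero) (covers zero)))

-- len w ≡ ℓ is implied by the chain and not needed.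
lemma3p14 : (n ℓ : ℕ) (w : Permutation′ n) → len w ≡ ℓ →
    (C : SatChain ℓ w) → GenSet C ⪯ℓ Inv w
lemma3p14 n ℓ w _ C =
  subst₂ _⪯ℓ_ G++Inv-id≡G Inv-end≡Inv-w (chain-⪯ℓ ℓ elems gens covers)
  where
  open SatChain C
  G++Inv-id≡G : toList gens ++ Inv (elems zero) ≡ toList gens
  G++Inv-id≡G = trans (cong (toList gens ++_) (Inv-identity {w = elems zero} start))
                      (List.++-identityʳ (toList gens))
  Inv-end≡Inv-w : Inv (elems (fromℕ ℓ)) ≡ Inv w
  Inv-end≡Inv-w = Inv-cong {w = elems (fromℕ ℓ)} {w} finish
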